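{- The following two statements are equivalent. (Frankl's conjecture) For every $n\geq 1$ and every union-closed family $\mathcal{F}\subset 2^{M_n}$ with $\bigcup_{A\in\mathcal{F}}A=M_n$, there exists an element $x\in M_n$ with $|\{F\in\mathcal{F}: x\in F\}|\geq \frac12|\mathcal{F}|$. (Nagel's conjecture) For every $n\geq 1$ and every union-closed family $\mathcal{F}\subset 2^{M_n}$ with $\bigcup_{A\in\mathcal{F}}A=M_n$, if the elements of $M_n$ are labeled so that $$|\{F\in\mathcal{F}: 1\in F\}|\geq |\{F\in\mathcal{F}: 2\in F\}|\geq\cdots\geq|\{F\in\mathcal{F}: n\in F\}|,$$ then for every $k\in\{1,2,\dots,n\}$, $$|\{F\in\mathcal{F}: k\in F\}|\geq \frac{1}{2^{k-1}+1}|\mathcal{F}|.$$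
   Context: $M_n=\{1,2,\dots,n\}$. A family $\mathcal{F}$ of sets is union-closed if $A\cup B\in\mathcal{F}$ for all $A,B\in\mathcal{F}$. $|X|$ denotes the cardinality of a set $X$. -}

module Defs where

open import Data.Nat using (ℕ; suc; _+_; _*_; _^_; _≤_)
open import Data.Fin using (Fin; toℕ)
import Data.Fin as Fin
open import Data.Fin.Subset using (Subset; _∈_; _∪_)
open import Data.Fin.Subset.Properties using (_∈?_)
open import Data.List using (List; length; filter)
open import Data.List.Relation.Unary.Unique.Propositional using (Unique)
import Data.List.Membership.Propositional as L
open import Data.Product using (Σ; _×_; ∃)

-- A family F ⊆ 2^{M_n}, with M_n represented by Fin n (element i ↔ i+1),
-- given as a duplicate-free list of subsets (so |F| = length).
record Family (n : ℕ) : Set where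
  constructor family
  field
    sets   : List (Subset n)
    unique : Unique sets
open Family public

card : ∀ {n} → Family n → ℕ
card F = length (sets F)

deg : ∀ {n} → Family n → Fin n → ℕ
deg F x = length (filter (x ∈?_) (sets F))

UnionClosed : ∀ {n} → Family n → Set
UnionClosed F = ∀ A B → A L.∈ sets F → B L.∈ sets F → (A ∪ B) L.∈ sets F

CoversAll : ∀ {n} → Family n → Set
CoversAll F = ∀ x → Σ _ λ A → A L.∈ sets F × x ∈ A

Frankl : Set
Frankl = ∀ n → 1 ≤ n → (F : Family n) → UnionClosed F → CoversAll F →
         Σ (Fin n) λ x → card F ≤ 2 * deg F x

-- element k of M_n is Fin index k-1, so 2^{k-1} = 2 ^ toℕ i
Nagel : Set
Nagel = ∀ n → 1 ≤ n → (F : Family n) → UnionClosed F → CoversAll F →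
        (∀ (i j : Fin n) → i Fin.≤ j → deg F j ≤ deg F i) →
        ∀ (i : Fin n) → card F ≤ (2 ^ toℕ i + 1) * deg F i

{-# OPTIONS --safe #-}
-- Frankl ⇒ Nagel: fix k and t = k − 1. Frankl applied to the trace G of F on {k, …, n}
-- gives j ≥ k with codeg_G j ≤ deg_G j ≤ deg_F j. A set of F avoiding j is determined by
-- its trace, a set of G avoiding j, and its part in {1, …, t}; so codeg_F j ≤ 2^t codeg_G j
-- and |F| = deg_F j + codeg_F j ≤ (2^t + 1) deg_F j ≤ (2^t + 1) deg_F k.
-- Nagel ⇒ Frankl: relabel the ground set by decreasing degree and take k = 1.
module Submission where

open import Defs
open import Function.Bundles using (_⇔_; mk⇔)
open import Function.Definitions using (StrictlySurjective)
open import Function using (_∘_; id)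
open import Data.Nat using (ℕ; zero; suc; _+_; _*_; _^_; _∸_; _≤_; z≤n; s≤s)
open import Data.Nat.Properties
open import Data.Bool using (_∨_)
import Data.Bool.Properties as Bool
open import Data.Fin using (Fin; toℕ; _↑ˡ_; _↑ʳ_)
import Data.Fin as Fin
open import Data.Fin.Properties using (toℕ-↑ʳ; toℕ<n; toℕ-cast; cast-involutive)
open import Data.Fin.Subset using (Subset; _∈_; _∪_; inside; outside)
open import Data.Fin.Subset.Properties using (_∈?_)
open import Data.Vec using ([]; _∷_; lookup; tabulate)
import Data.Vec as Vec
open import Data.Vec.Properties using (lookup∘tabulate; tabulate∘lookup; lookup-zipWith; ≡-dec; []=⇒lookup; lookup⇒[]=)
open import Data.Vec.Relation.Binary.Pointwise.Extensional using (ext; Pointwise-≡⇒≡)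
open import Data.List using (List; []; _∷_; _++_; length; filter; map; deduplicate; cartesianProductWith; cartesianProduct; allFin)
import Data.List as List
open import Data.List.Properties using (length-map; length-++; length-removeAt′; length-tabulate)
import Data.List.Relation.Unary.All as All
open import Data.List.Relation.Unary.Any using (here; there; index; _─_)
open import Data.List.Relation.Unary.Any.Properties using (lookup-index)
open import Data.List.Relation.Unary.Unique.Propositional using (Unique; _∷_)
import Data.List.Relation.Unary.Unique.Propositional.Properties as Unique
open import Data.List.Relation.Unary.Unique.DecPropositional.Properties using (deduplicate-!)
import Data.List.Membership.Propositional as L
open import Data.List.Membership.Propositional.Properties
  using (∈-map⁺; ∈-map⁻; ∈-filter⁺; ∈-filter⁻; ∈-deduplicate⁺; ∈-deduplicate⁻; ∈-cartesianProductWith⁺; ∈-cartesianProduct⁺; ∈-allFin)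
open import Data.List.Relation.Binary.Subset.Propositional using (_⊆_)
open import Data.List.Relation.Binary.Permutation.Propositional using (↭-sym)
open import Data.List.Relation.Binary.Permutation.Propositional.Properties using (∈-resp-↭; ↭-length)
open import Data.List.Relation.Unary.Sorted.TotalOrder.Properties using (lookup-mono-≤)
import Data.List.Sort as Sort
import Relation.Binary.Construct.On as On
import Relation.Binary.Construct.Flip.Ord as Flip
open import Relation.Binary.Bundles using (DecTotalOrder)
open import Relation.Binary.Definitions using (DecidableEquality)
open import Data.Product using (∃; ∃-syntax; _×_; _,_; uncurry)
open import Data.Empty using (⊥-elim)
open import Relation.Nullary using (yes; no)
open import Relation.Unary using (Pred; Decidable)
open import Relation.Unary.Properties using (∁?)
open import Relation.Binary.PropositionalEquality

module _ {a} {A : Set a} where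

  ∈-─⁺ : ∀ {x y} {ys : List A} (x∈ys : x L.∈ ys) → x ≢ y → y L.∈ ys → y L.∈ (ys ─ x∈ys)
  ∈-─⁺ (here refl) x≢y (here refl) = ⊥-elim (x≢y refl)
  ∈-─⁺ (here refl) _   (there y∈ys) = y∈ys
  ∈-─⁺ (there _)   _   (here refl)  = here refl
  ∈-─⁺ (there x∈ys) x≢y (there y∈ys) = there (∈-─⁺ x∈ys x≢y y∈ys)

  Unique-⊆⇒length-≤ : ∀ {xs ys : List A} → Unique xs → xs ⊆ ys → length xs ≤ length ys
  Unique-⊆⇒length-≤ {[]}     _          _     = z≤n
  Unique-⊆⇒length-≤ {x ∷ xs} {ys} (x≢xs ∷ u) xs⊆ys =
    subst (suc (length xs) ≤_) (sym (length-removeAt′ ys (index x∈ys)))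
      (s≤s (Unique-⊆⇒length-≤ u λ y∈xs → ∈-─⁺ x∈ys (All.lookup x≢xs y∈xs) (xs⊆ys (there y∈xs))))
    where x∈ys = xs⊆ys (here refl)

  length-filter+length-filter-∁ : ∀ {p} {P : Pred A p} (P? : Decidable P) xs →
    length (filter P? xs) + length (filter (∁? P?) xs) ≡ length xs
  length-filter+length-filter-∁ P? [] = refl
  length-filter+length-filter-∁ P? (x ∷ xs) with P? x
  ... | yes _ = cong suc (length-filter+length-filter-∁ P? xs)
  ... | no  _ = trans (+-suc _ _) (cong suc (length-filter+length-filter-∁ P? xs))

length-cartesianProductWith : ∀ {a b c} {A : Set a} {B : Set b} {C : Set c} (f : A → B → C) xs ys →
  length (cartesianProductWith f xs ys) ≡ length xs * length ys
length-cartesianProductWith f []       ys = refl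
length-cartesianProductWith f (x ∷ xs) ys = begin
  length (map (f x) ys ++ cartesianProductWith f xs ys)           ≡⟨ length-++ (map (f x) ys) ⟩
  length (map (f x) ys) + length (cartesianProductWith f xs ys)   ≡⟨ cong₂ _+_ (length-map (f x) ys) (length-cartesianProductWith f xs ys) ⟩
  length ys + length xs * length ys                               ∎
  where open ≡-Reasoning

preimage : ∀ {m n} → (Fin m → Fin n) → Subset n → Subset m
preimage f A = tabulate (lookup A ∘ f)

module _ {m n} (f : Fin m → Fin n) where

  lookup-preimage : ∀ A j → lookup (preimage f A) j ≡ lookup A (f j)
  lookup-preimage A = lookup∘tabulate (lookup A ∘ f)

  ∈-preimage⁺ : ∀ {A j} → f j ∈ A → j ∈ preimage f A
  ∈-preimage⁺ {A} {j} fj∈A = lookup⇒[]= j _ (trans (lookup-preimage A j) ([]=⇒lookup fj∈A))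

  ∈-preimage⁻ : ∀ {A j} → j ∈ preimage f A → f j ∈ A
  ∈-preimage⁻ {A} {j} j∈f⁻¹A = lookup⇒[]= (f j) A (trans (sym (lookup-preimage A j)) ([]=⇒lookup j∈f⁻¹A))

  preimage-∪ : ∀ A B → preimage f (A ∪ B) ≡ preimage f A ∪ preimage f B
  preimage-∪ A B = Pointwise-≡⇒≡ (ext λ j → begin
    lookup (preimage f (A ∪ B)) j                      ≡⟨ lookup-preimage (A ∪ B) j ⟩
    lookup (A ∪ B) (f j)                               ≡⟨ lookup-zipWith _ (f j) A B ⟩
    lookup A (f j) ∨ lookup B (f j)                    ≡⟨ cong₂ _∨_ (lookup-preimage A j) (lookup-preimage B j) ⟨
    lookup (preimage f A) j ∨ lookup (preimage f B) j  ≡⟨ lookup-zipWith _ j (preimage f A) (preimage f B) ⟨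
    lookup (preimage f A ∪ preimage f B) j             ∎)
    where open ≡-Reasoning

  preimage-injective : StrictlySurjective _≡_ f → ∀ {A B} → preimage f A ≡ preimage f B → A ≡ B
  preimage-injective f-surjective {A} {B} eq = Pointwise-≡⇒≡ (ext λ x → lookup-agrees (f-surjective x))
    where
    lookup-agrees : ∀ {x} → ∃ (λ j → f j ≡ x) → lookup A x ≡ lookup B x
    lookup-agrees (j , refl) = begin
      lookup A (f j)               ≡⟨ lookup-preimage A j ⟨
      lookup (preimage f A) j      ≡⟨ cong (λ C → lookup C j) eq ⟩
      lookup (preimage f B) j      ≡⟨ lookup-preimage B j ⟩
      lookup B (f j)               ∎
      where open ≡-Reasoning

preimage-↑ˡ++preimage-↑ʳ : ∀ t {m} (A : Subset (t + m)) → preimage (_↑ˡ m) A Vec.++ preimage (t ↑ʳ_) A ≡ A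
preimage-↑ˡ++preimage-↑ʳ zero    A       = tabulate∘lookup A
preimage-↑ˡ++preimage-↑ʳ (suc t) (x ∷ A) = cong (x ∷_) (preimage-↑ˡ++preimage-↑ʳ t A)

subsets : ∀ t → List (Subset t)
subsets zero    = [] ∷ []
subsets (suc t) = cartesianProductWith _∷_ (inside ∷ outside ∷ []) (subsets t)

length-subsets : ∀ t → length (subsets t) ≡ 2 ^ t
length-subsets zero    = refl
length-subsets (suc t) = trans (length-cartesianProductWith _∷_ (inside ∷ outside ∷ []) (subsets t))
                               (cong (2 *_) (length-subsets t))

∈-subsets : ∀ {t} (A : Subset t) → A L.∈ subsets t
∈-subsets []      = here refl
∈-subsets (x ∷ A) = ∈-cartesianProductWith⁺ _∷_ {xs = inside ∷ outside ∷ []} (∈-sides x) (∈-subsets A)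
  where
  ∈-sides : ∀ x → x L.∈ inside ∷ outside ∷ []
  ∈-sides inside  = here refl
  ∈-sides outside = there (here refl)

module _ {n} (F : Family n) where

  codeg : Fin n → ℕ
  codeg x = length (filter (∁? (x ∈?_)) (sets F))

  deg+codeg≡card : ∀ x → deg F x + codeg x ≡ card F
  deg+codeg≡card x = length-filter+length-filter-∁ (x ∈?_) (sets F)

  card≤2*deg⇒codeg≤deg : ∀ x → card F ≤ 2 * deg F x → codeg x ≤ deg F x
  card≤2*deg⇒codeg≤deg x card≤2*deg = +-cancelˡ-≤ (deg F x) _ _ (begin
    deg F x + codeg x      ≡⟨ deg+codeg≡card x ⟩
    card F                 ≤⟨ card≤2*deg ⟩
    2 * deg F x            ≡⟨ cong (deg F x +_) (+-identityʳ (deg F x)) ⟩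
    deg F x + deg F x      ∎)
    where open ≤-Reasoning

_≟ₛ_ : ∀ {n} → DecidableEquality (Subset n)
_≟ₛ_ = ≡-dec Bool._≟_

trace : ∀ {m n} → (Fin m → Fin n) → Family n → Family m
trace f F = family (deduplicate _≟ₛ_ (map (preimage f) (sets F))) (deduplicate-! _ _)

module _ {m n} (f : Fin m → Fin n) (F : Family n) where

  ∈-trace⁺ : ∀ {A} → A L.∈ sets F → preimage f A L.∈ sets (trace f F)
  ∈-trace⁺ A∈F = ∈-deduplicate⁺ _≟ₛ_ (∈-map⁺ (preimage f) A∈F)

  ∈-trace⁻ : ∀ {B} → B L.∈ sets (trace f F) → ∃ λ A → A L.∈ sets F × B ≡ preimage f A
  ∈-trace⁻ B∈trace = ∈-map⁻ (preimage f) (∈-deduplicate⁻ _≟ₛ_ (map (preimage f) (sets F)) B∈trace)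

  trace-unionClosed : UnionClosed F → UnionClosed (trace f F)
  trace-unionClosed F-uc _ _ A′∈ B′∈ with ∈-trace⁻ A′∈ | ∈-trace⁻ B′∈
  ... | A , A∈F , refl | B , B∈F , refl =
    subst (L._∈ sets (trace f F)) (preimage-∪ f A B) (∈-trace⁺ (F-uc A B A∈F B∈F))

  trace-coversAll : CoversAll F → CoversAll (trace f F)
  trace-coversAll F-covers j with F-covers (f j)
  ... | A , A∈F , fj∈A = preimage f A , ∈-trace⁺ A∈F , ∈-preimage⁺ f fj∈A

  deg-trace-≤ : ∀ j → deg (trace f F) j ≤ deg F (f j)
  deg-trace-≤ j = begin
    deg (trace f F) j                                      ≤⟨ Unique-⊆⇒length-≤ (Unique.filter⁺ _ (unique (trace f F))) ⊆-image ⟩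
    length (map (preimage f) (filter (f j ∈?_) (sets F)))  ≡⟨ length-map (preimage f) (filter (f j ∈?_) (sets F)) ⟩
    deg F (f j)                                            ∎
    where
    open ≤-Reasoning
    ⊆-image : filter (j ∈?_) (sets (trace f F)) ⊆ map (preimage f) (filter (f j ∈?_) (sets F))
    ⊆-image B∈ with ∈-filter⁻ (j ∈?_) B∈
    ... | B∈trace , j∈B with ∈-trace⁻ B∈trace
    ... | A , A∈F , refl = ∈-map⁺ (preimage f) (∈-filter⁺ (f j ∈?_) A∈F (∈-preimage⁻ f j∈B))

  module _ (f-surjective : StrictlySurjective _≡_ f) where

    card-trace-≥ : card F ≤ card (trace f F)
    card-trace-≥ = begin
      card F                             ≡⟨ length-map (preimage f) (sets F) ⟨
      length (map (preimage f) (sets F)) ≤⟨ Unique-⊆⇒length-≤ (Unique.map⁺ (preimage-injective f f-surjective) (unique F)) ⊆-trace ⟩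
      card (trace f F)                   ∎
      where
      open ≤-Reasoning
      ⊆-trace : map (preimage f) (sets F) ⊆ sets (trace f F)
      ⊆-trace = ∈-deduplicate⁺ _≟ₛ_

    deg-trace-≥ : ∀ j → deg F (f j) ≤ deg (trace f F) j
    deg-trace-≥ j = begin
      deg F (f j)                                            ≡⟨ length-map (preimage f) (filter (f j ∈?_) (sets F)) ⟨
      length (map (preimage f) (filter (f j ∈?_) (sets F)))  ≤⟨ Unique-⊆⇒length-≤ unique-image ⊆-trace ⟩
      deg (trace f F) j                                      ∎
      where
      open ≤-Reasoning
      unique-image : Unique (map (preimage f) (filter (f j ∈?_) (sets F)))
      unique-image = Unique.map⁺ (preimage-injective f f-surjective) (Unique.filter⁺ _ (unique F))
      ⊆-trace : map (preimage f) (filter (f j ∈?_) (sets F)) ⊆ filter (j ∈?_) (sets (trace f F))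
      ⊆-trace B∈ with ∈-map⁻ (preimage f) B∈
      ... | A , A∈ , refl with ∈-filter⁻ (f j ∈?_) A∈
      ... | A∈F , fj∈A = ∈-filter⁺ (j ∈?_) (∈-trace⁺ A∈F) (∈-preimage⁺ f fj∈A)

split : ∀ t {m} → Subset (t + m) → Subset t × Subset m
split t {m} A = preimage (_↑ˡ m) A , preimage (t ↑ʳ_) A

split-injective : ∀ t {m} {A B : Subset (t + m)} → split t A ≡ split t B → A ≡ B
split-injective t {A = A} {B} eq = begin
  A                             ≡⟨ preimage-↑ˡ++preimage-↑ʳ t A ⟨
  uncurry Vec._++_ (split t A)  ≡⟨ cong (uncurry Vec._++_) eq ⟩
  uncurry Vec._++_ (split t B)  ≡⟨ preimage-↑ˡ++preimage-↑ʳ t B ⟩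
  B                             ∎
  where open ≡-Reasoning

codeg≤2^t*codeg-trace : ∀ t {m} (F : Family (t + m)) j →
  codeg F (t ↑ʳ j) ≤ 2 ^ t * codeg (trace (t ↑ʳ_) F) j
codeg≤2^t*codeg-trace t F j = begin
  codeg F (t ↑ʳ j)                                 ≡⟨ length-map (split t) avoiding ⟨
  length (map (split t) avoiding)                  ≤⟨ Unique-⊆⇒length-≤ unique-splits ⊆-product ⟩
  length (cartesianProduct (subsets t) avoiding′)  ≡⟨ length-cartesianProductWith _,_ (subsets t) avoiding′ ⟩
  length (subsets t) * codeg G j                   ≡⟨ cong (_* codeg G j) (length-subsets t) ⟩
  2 ^ t * codeg G j                                ∎
  where
  open ≤-Reasoning
  G = trace (t ↑ʳ_) F
  avoiding : List (Subset _)
  avoiding = filter (∁? (t ↑ʳ j ∈?_)) (sets F)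
  avoiding′ : List (Subset _)
  avoiding′ = filter (∁? (j ∈?_)) (sets G)
  unique-splits : Unique (map (split t) avoiding)
  unique-splits = Unique.map⁺ (split-injective t) (Unique.filter⁺ _ (unique F))
  ⊆-product : map (split t) avoiding ⊆ cartesianProduct (subsets t) avoiding′
  ⊆-product p∈ with ∈-map⁻ (split t) p∈
  ... | A , A∈ , refl with ∈-filter⁻ (∁? (t ↑ʳ j ∈?_)) {xs = sets F} A∈
  ... | A∈F , x∉A = ∈-cartesianProduct⁺ {xs = subsets t} {ys = avoiding′} (∈-subsets _)
                      (∈-filter⁺ (∁? (j ∈?_)) (∈-trace⁺ (t ↑ʳ_) F A∈F) (x∉A ∘ ∈-preimage⁻ (t ↑ʳ_)))

frankl⇒deg-bound-above : Frankl → ∀ {n} t m → t + m ≡ n → 1 ≤ m →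
  (F : Family n) → UnionClosed F → CoversAll F →
  ∃[ x ] t ≤ toℕ x × card F ≤ (2 ^ t + 1) * deg F x
frankl⇒deg-bound-above frankl t m refl 1≤m F F-uc F-covers
  with frankl m 1≤m (trace (t ↑ʳ_) F) (trace-unionClosed (t ↑ʳ_) F F-uc) (trace-coversAll (t ↑ʳ_) F F-covers)
... | j , card≤2*deg = t ↑ʳ j , t≤x , (begin
  card F                                    ≡⟨ deg+codeg≡card F x ⟨
  deg F x + codeg F x                       ≤⟨ +-monoʳ-≤ (deg F x) (codeg≤2^t*codeg-trace t F j) ⟩
  deg F x + 2 ^ t * codeg G j               ≤⟨ +-monoʳ-≤ (deg F x) (*-monoʳ-≤ (2 ^ t) codeg≤deg) ⟩
  deg F x + 2 ^ t * deg F x                 ≡⟨ cong (_* deg F x) (+-comm 1 (2 ^ t)) ⟩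
  (2 ^ t + 1) * deg F x                     ∎)
  where
  open ≤-Reasoning
  G = trace (t ↑ʳ_) F
  x = t ↑ʳ j
  t≤x : t ≤ toℕ x
  t≤x = subst (t ≤_) (sym (toℕ-↑ʳ t j)) (m≤m+n t (toℕ j))
  codeg≤deg : codeg G j ≤ deg F x
  codeg≤deg = ≤-trans (card≤2*deg⇒codeg≤deg G j card≤2*deg) (deg-trace-≤ (t ↑ʳ_) F j)

frankl⇒nagel : Frankl → Nagel
frankl⇒nagel frankl n _ F F-uc F-covers sorted i
  with frankl⇒deg-bound-above frankl (toℕ i) (n ∸ toℕ i) (m+[n∸m]≡n (<⇒≤ (toℕ<n i)))
         (m<n⇒0<n∸m (toℕ<n i)) F F-uc F-covers
... | x , i≤x , card≤ = ≤-trans card≤ (*-monoʳ-≤ (2 ^ toℕ i + 1) (sorted i x i≤x))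

relabel-decreasing : ∀ {n} (k : Fin n → ℕ) →
  ∃ λ (π : Fin n → Fin n) → StrictlySurjective _≡_ π × (∀ i j → i Fin.≤ j → k (π j) ≤ k (π i))
relabel-decreasing {n} k = π , π-surjective , π-decreasing
  where
  byDecreasingKey : DecTotalOrder _ _ _
  byDecreasingKey = On.decTotalOrder (Flip.decTotalOrder ≤-decTotalOrder) k
  open Sort byDecreasingKey using (sort; sort-↭; sort-↗)
  ks = sort (allFin n)
  |ks|≡n : length ks ≡ n
  |ks|≡n = trans (↭-length (sort-↭ (allFin n))) (length-tabulate id)
  π : Fin n → Fin n
  π i = List.lookup ks (Fin.cast (sym |ks|≡n) i)
  π-surjective : StrictlySurjective _≡_ π
  π-surjective x = Fin.cast |ks|≡n (index x∈ks) , (begin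
    List.lookup ks (Fin.cast (sym |ks|≡n) (Fin.cast |ks|≡n (index x∈ks)))
      ≡⟨ cong (List.lookup ks) (cast-involutive (sym |ks|≡n) |ks|≡n _) ⟩
    List.lookup ks (index x∈ks)
      ≡⟨ lookup-index x∈ks ⟨
    x ∎)
    where
    open ≡-Reasoning
    x∈ks : x L.∈ ks
    x∈ks = ∈-resp-↭ (↭-sym (sort-↭ (allFin n))) (∈-allFin x)
  π-decreasing : ∀ i j → i Fin.≤ j → k (π j) ≤ k (π i)
  π-decreasing i j i≤j = lookup-mono-≤ (DecTotalOrder.totalOrder byDecreasingKey) (sort-↗ (allFin n))
    (subst₂ _≤_ (sym (toℕ-cast _ i)) (sym (toℕ-cast _ j)) i≤j)

nagel⇒frankl : Nagel → Frankl
nagel⇒frankl nagel n@(suc _) _ F F-uc F-covers with relabel-decreasing (deg F)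
... | π , π-surjective , π-decreasing = π Fin.zero , (begin
  card F                  ≤⟨ card-trace-≥ π F π-surjective ⟩
  card G                  ≤⟨ nagel n (s≤s z≤n) G (trace-unionClosed π F F-uc) (trace-coversAll π F F-covers) G-sorted Fin.zero ⟩
  2 * deg G Fin.zero      ≤⟨ *-monoʳ-≤ 2 (deg-trace-≤ π F Fin.zero) ⟩
  2 * deg F (π Fin.zero)  ∎)
  where
  open ≤-Reasoning
  G = trace π F
  G-sorted : ∀ i j → i Fin.≤ j → deg G j ≤ deg G i
  G-sorted i j i≤j = ≤-trans (deg-trace-≤ π F j) (≤-trans (π-decreasing i j i≤j) (deg-trace-≥ π F π-surjective i))

proposition3p1 : Frankl ⇔ Nagel
proposition3p1 = mk⇔ frankl⇒nagel nagel⇒frankl
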